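{- For every integer $n\ge 4$, \[ \operatorname{bn}(F_2(K_n)) \ge \begin{cases} \frac{n}{2}\left(\frac{n}{2}-1\right)+n-1 & \text{if } n \text{ is even},\\[2pt] \left(\frac{n-1}{2}\right)^2+n-1 & \text{if } n \text{ is odd}.\end{cases} \]
   Context: For a graph $G$, the $2$-token graph $F_2(G)$ has as vertices the $2$-element subsets of $V(G)$, two being adjacent when their symmetric difference is an edge of $G$. Two vertex sets of a graph touch if they share a vertex or some edge joins them. A bramble is a family of pairwise touching vertex sets each inducing a connected subgraph; its order is the minimum size of a set meeting every member; $\operatorname{bn}(G)$, the bramble number, is the maximum order of a bramble of $G$. -}

module Defs where

open import Level using (0ℓ)
open import Data.Nat using (ℕ; zero; suc; _+_; _*_; _∸_; _^_; _≤_; _<_)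
open import Data.Nat.DivMod using (_/_; _%_)
open import Data.Fin using (Fin)
open import Data.List using (List; length)
open import Data.List.Membership.Propositional using (_∈_)
open import Data.List.Relation.Unary.All using (All)
open import Data.Product using (Σ; ∃; _×_; _,_)
open import Data.Sum using (_⊎_)
open import Relation.Nullary using (¬_)
open import Relation.Binary.PropositionalEquality using (_≡_; _≢_)
open import Function.Bundles using (_⇔_)

record Graph : Set₁ where
  field
    V : Set
    E : V → V → Set
open Graph public

VSet : Graph → Set₁
VSet G = V G → Set

K : ℕ → Graph
K n = record { V = Fin n ; E = λ i j → i ≢ j }

-- 2-element subsets of V(G), encoded as ordered pairs (a , b) with a < b.
Pair2 : ℕ → Set
Pair2 n = Σ (Fin n × Fin n) (λ { (a , b) → Data.Fin._<_ a b })
  where import Data.Fin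

_∈₂_ : {n : ℕ} → Fin n → Pair2 n → Set
z ∈₂ ((a , b) , _) = (z ≡ a) ⊎ (z ≡ b)

inSymDiff : {n : ℕ} → Fin n → Pair2 n → Pair2 n → Set
inSymDiff z S T = (z ∈₂ S × ¬ (z ∈₂ T)) ⊎ (z ∈₂ T × ¬ (z ∈₂ S))

-- The 2-token graph of a graph G on vertex set Fin n:
-- S ~ T iff S Δ T = {x , y} for some edge xy of G.
F₂ : (n : ℕ) → (Fin n → Fin n → Set) → Graph
F₂ n EG = record
  { V = Pair2 n
  ; E = λ S T → ∃ λ x → ∃ λ y → EG x y × x ≢ y ×
          (∀ z → inSymDiff z S T ⇔ ((z ≡ x) ⊎ (z ≡ y)))
  }

F₂K : ℕ → Graph
F₂K n = F₂ n (E (K n))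

data WalkIn (G : Graph) (X : VSet G) : V G → V G → Set where
  stay : ∀ {x} → WalkIn G X x x
  step : ∀ {x y z} → E G x y → X y → WalkIn G X y z → WalkIn G X x z

Connected : (G : Graph) → VSet G → Set
Connected G X = (∃ λ v → X v) × (∀ x y → X x → X y → WalkIn G X x y)

Touch : (G : Graph) → VSet G → VSet G → Set
Touch G X Y = (∃ λ v → X v × Y v) ⊎ (∃ λ x → ∃ λ y → X x × Y y × E G x y)

IsBramble : (G : Graph) → List (VSet G) → Set₁
IsBramble G B = All (Connected G) B × (∀ X Y → X ∈ B → Y ∈ B → Touch G X Y)

Hits : (G : Graph) → List (V G) → List (VSet G) → Set₁
Hits G H B = All (λ X → ∃ λ v → v ∈ H × X v) B

-- bn(G) ≥ k : some bramble has order ≥ k, i.e. every set meeting all its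
-- members has at least k elements.
BnAtLeast : (G : Graph) → ℕ → Set₁
BnAtLeast G k = Σ (List (VSet G)) λ B → IsBramble G B ×
                  (∀ (H : List (V G)) → Hits G H B → k ≤ length H)

bound : ℕ → ℕ
bound n with n % 2
... | zero = (n / 2) * (n / 2 ∸ 1) + (n ∸ 1)
... | suc _ = ((n ∸ 1) / 2) ^ 2 + (n ∸ 1)

-- The bramble consists of the edge sets of walks in K_n visiting more than half of the
-- vertices (vertex 0 breaking ties). Two such walks share a vertex z, and their edges
-- {z,y₁}, {z,y₂} at z are equal or adjacent tokens, so the edge sets touch.
-- If H meets every member, each component of K_n − H has at most ⌊n/2⌋ vertices, and the
-- component of 0 at most ⌊(n-1)/2⌋. Ordering the components by least vertex and cutting
-- at the right component splits the vertices into three classes of sizes X ≤ ⌊(n-1)/2⌋ and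
-- Y, Z ≤ ⌊n/2⌋; every pair from different classes is an edge of H, whence
-- |H| ≥ XY + YZ + ZX ≥ ⌊(n-1)/2⌋⌊n/2⌋ + n - 1.

module Submission where

open import Defs
open import Data.Nat using (ℕ; zero; suc; _+_; _*_; _∸_; _^_; _≤_; _<_; z≤n; s≤s; _≤?_; _<?_)
open import Data.Nat.Properties
open import Data.Nat.DivMod using (_/_; _%_; m*n%n≡0; m*n/n≡m; [m+kn]%n≡m%n)
open import Data.Nat.Tactic.RingSolver using (solve-∀)
open import Algebra.Properties.Semiring.Sum +-*-semiring
  using (sum-syntax; sum-cong-≗; ∑-distrib-+; ∑-comm; *-distribˡ-sum; *-distribʳ-sum)
open import Data.Fin as Fin using (Fin; zero; suc; toℕ)
open import Data.Fin.Patterns using (0F; 1F; 2F)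
import Data.Fin.Properties as Finₚ
open import Data.List using (List; []; _∷_; length; map; filter; concatMap; allFin)
open import Data.List.Membership.Propositional using (_∈_; _∉_; lose; find)
open import Data.List.Membership.Propositional.Properties
  using (∈-map⁺; ∈-map⁻; ∈-filter⁺; ∈-filter⁻; ∈-concatMap⁺; ∈-allFin)
import Data.List.Membership.DecPropositional as DecMembership
open import Data.List.Relation.Unary.All as All using (All; []; _∷_)
open import Data.List.Relation.Unary.All.Properties using (¬All⇒Any¬)
open import Data.List.Relation.Unary.Any as Any using (Any; here; there; any?)
open import Data.List.Relation.Unary.Linked as Linked using (Linked; []; [-]; _∷_)
open import Data.Product using (∃; ∃₂; _×_; _,_; proj₁; proj₂)
open import Data.Sum using (_⊎_; inj₁; inj₂; [_,_]; map₁)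
open import Data.Empty using (⊥-elim)
open import Function using (_∘_; id)
open import Function.Bundles using (mk⇔)
open import Relation.Binary using (tri<; tri≈; tri>)
open import Relation.Nullary using (¬_; Dec; yes; no; ¬?)
open import Relation.Nullary.Decidable using (_×-dec_; _⊎-dec_; _→-dec_; decidable-stable)
open import Relation.Binary.PropositionalEquality using (_≡_; _≢_; refl; sym; trans; cong; cong₂; subst; module ≡-Reasoning)

𝟙 : {P : Set} → Dec P → ℕ
𝟙 (yes _) = 1
𝟙 (no _) = 0

𝟙≤1 : {P : Set} (d : Dec P) → 𝟙 d ≤ 1
𝟙≤1 (yes _) = s≤s z≤n
𝟙≤1 (no _) = z≤n

𝟙-yes : {P : Set} (d : Dec P) → P → 𝟙 d ≡ 1
𝟙-yes (yes _) _ = refl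
𝟙-yes (no ¬p) p = ⊥-elim (¬p p)

𝟙-no : {P : Set} (d : Dec P) → ¬ P → 𝟙 d ≡ 0
𝟙-no (yes p) ¬p = ⊥-elim (¬p p)
𝟙-no (no _) _ = refl

𝟙-both : {P Q : Set} (dP : Dec P) (dQ : Dec Q) → 1 < 𝟙 dP + 𝟙 dQ → P × Q
𝟙-both (yes p) (yes q) _ = p , q
𝟙-both (yes _) (no _) (s≤s ())
𝟙-both (no _) (yes _) (s≤s ())

𝟙-mono : {P Q : Set} (dP : Dec P) (dQ : Dec Q) → (P → Q) → 𝟙 dP ≤ 𝟙 dQ
𝟙-mono (yes p) dQ f = ≤-reflexive (sym (𝟙-yes dQ (f p)))
𝟙-mono (no _) dQ f = z≤n

𝟙-cong : {P Q : Set} (dP : Dec P) (dQ : Dec Q) → (P → Q) → (Q → P) → 𝟙 dP ≡ 𝟙 dQ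
𝟙-cong dP dQ f g = ≤-antisym (𝟙-mono dP dQ f) (𝟙-mono dQ dP g)

𝟙-⊎ : {P Q R : Set} (dR : Dec R) (dP : Dec P) (dQ : Dec Q) → (R → P ⊎ Q) → 𝟙 dR ≤ 𝟙 dP + 𝟙 dQ
𝟙-⊎ (no _) dP dQ f = z≤n
𝟙-⊎ (yes r) dP dQ f with f r
... | inj₁ p = ≤-trans (𝟙-mono (yes r) dP (λ _ → p)) (m≤m+n _ _)
... | inj₂ q = ≤-trans (𝟙-mono (yes r) dQ (λ _ → q)) (m≤n+m _ _)

𝟙-¬ : {P : Set} (d : Dec P) → 𝟙 (¬? d) + 𝟙 d ≡ 1
𝟙-¬ (yes _) = refl
𝟙-¬ (no _) = refl

𝟙-disjoint-⊎ : {P Q R : Set} (dR : Dec R) (dP : Dec P) (dQ : Dec Q) →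
               (R → P ⊎ Q) → (P → R) → (Q → R) → ¬ (P × Q) → 𝟙 dR ≡ 𝟙 dP + 𝟙 dQ
𝟙-disjoint-⊎ dR (yes p) (yes q) _ _ _ disjoint = ⊥-elim (disjoint (p , q))
𝟙-disjoint-⊎ dR (yes p) (no _) _ P→R _ _ = 𝟙-yes dR (P→R p)
𝟙-disjoint-⊎ dR (no _) (yes q) _ _ Q→R _ = 𝟙-yes dR (Q→R q)
𝟙-disjoint-⊎ dR (no ¬p) (no ¬q) R→P⊎Q _ _ _ = 𝟙-no dR ([ ¬p , ¬q ] ∘ R→P⊎Q)

¬→-split : {A B : Set} → Dec A → ¬ (A → B) → A × ¬ B
¬→-split (yes a) ¬A→B = a , λ b → ¬A→B (λ _ → b)
¬→-split (no ¬a) ¬A→B = ⊥-elim (¬A→B (λ a → ⊥-elim (¬a a)))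

𝟙-× : {P Q : Set} (dP : Dec P) (dQ : Dec Q) → 𝟙 (dP ×-dec dQ) ≡ 𝟙 dP * 𝟙 dQ
𝟙-× (yes _) (yes _) = refl
𝟙-× (yes _) (no _) = refl
𝟙-× (no _) _ = refl

∑-mono-≤ : ∀ n {f g : Fin n → ℕ} → (∀ i → f i ≤ g i) → ∑[ i < n ] f i ≤ ∑[ i < n ] g i
∑-mono-≤ zero f≤g = z≤n
∑-mono-≤ (suc n) f≤g = +-mono-≤ (f≤g zero) (∑-mono-≤ n (λ i → f≤g (suc i)))

∑-const : ∀ n c → ∑[ i < n ] c ≡ n * c
∑-const zero c = refl
∑-const (suc n) c = cong (c +_) (∑-const n c)

∑-zero : ∀ n → ∑[ i < n ] 0 ≡ 0
∑-zero n = trans (∑-const n 0) (*-zeroʳ n)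

∑-one : ∀ n → ∑[ i < n ] 1 ≡ n
∑-one n = trans (∑-const n 1) (*-identityʳ n)

term≤∑ : ∀ n (f : Fin n → ℕ) i → f i ≤ ∑[ j < n ] f j
term≤∑ (suc n) f zero = m≤m+n _ _
term≤∑ (suc n) f (suc i) = ≤-trans (term≤∑ n (λ j → f (suc j)) i) (m≤n+m _ _)

∑-pigeonhole : ∀ n (f g : Fin n → ℕ) → ∑[ i < n ] g i < ∑[ i < n ] f i → ∃ λ i → g i < f i
∑-pigeonhole (suc n) f g ∑g<∑f with g zero <? f zero
... | yes g₀<f₀ = zero , g₀<f₀
... | no g₀≮f₀ =
  let i , gᵢ<fᵢ = ∑-pigeonhole n (λ i → f (suc i)) (λ i → g (suc i))
                    (+-cancelˡ-< (g zero) _ _ (<-≤-trans ∑g<∑f (+-monoˡ-≤ _ (≮⇒≥ g₀≮f₀))))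
  in suc i , gᵢ<fᵢ

∑-pick : ∀ r (g : Fin r → ℕ) a → ∑[ k < r ] (𝟙 (k Fin.≟ a) * g k) ≡ g a
∑-pick (suc r) g zero = trans (cong₂ _+_ (+-identityʳ (g zero)) (∑-zero r)) (+-identityʳ (g zero))
∑-pick (suc r) g (suc a) = trans (sum-cong-≗ {r} shift) (∑-pick r (λ k → g (suc k)) a)
  where
  shift : ∀ k → 𝟙 (suc k Fin.≟ suc a) * g (suc k) ≡ 𝟙 (k Fin.≟ a) * g (suc k)
  shift k = cong (_* g (suc k)) (𝟙-cong (suc k Fin.≟ suc a) (k Fin.≟ a) Finₚ.suc-injective (cong suc))

∑-𝟙-≟ : ∀ n (a : Fin n) → ∑[ i < n ] 𝟙 (i Fin.≟ a) ≡ 1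
∑-𝟙-≟ n a = trans (sum-cong-≗ (λ i → sym (*-identityʳ (𝟙 (i Fin.≟ a))))) (∑-pick n (λ _ → 1) a)

∑∑-distrib-+ : ∀ n (f g : Fin n → Fin n → ℕ) →
               ∑[ b < n ] ∑[ c < n ] (f b c + g b c) ≡ ∑[ b < n ] ∑[ c < n ] f b c + ∑[ b < n ] ∑[ c < n ] g b c
∑∑-distrib-+ n f g =
  trans (sum-cong-≗ (λ b → ∑-distrib-+ (f b) (g b))) (∑-distrib-+ (λ b → ∑[ c < n ] f b c) (λ b → ∑[ c < n ] g b c))

∑∑-𝟙-point : ∀ n (x y : Fin n) → ∑[ b < n ] ∑[ c < n ] 𝟙 (b Fin.≟ x ×-dec c Fin.≟ y) ≡ 1
∑∑-𝟙-point n x y = begin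
  ∑[ b < n ] ∑[ c < n ] 𝟙 (b Fin.≟ x ×-dec c Fin.≟ y)   ≡⟨ sum-cong-≗ (λ b → sum-cong-≗ (λ c → 𝟙-× (b Fin.≟ x) (c Fin.≟ y))) ⟩
  ∑[ b < n ] ∑[ c < n ] (𝟙 (b Fin.≟ x) * 𝟙 (c Fin.≟ y)) ≡⟨ sum-cong-≗ (λ b → *-distribˡ-sum (𝟙 (b Fin.≟ x)) (λ c → 𝟙 (c Fin.≟ y))) ⟨
  ∑[ b < n ] (𝟙 (b Fin.≟ x) * ∑[ c < n ] 𝟙 (c Fin.≟ y)) ≡⟨ ∑-pick n (λ _ → ∑[ c < n ] 𝟙 (c Fin.≟ y)) x ⟩
  ∑[ c < n ] 𝟙 (c Fin.≟ y)                             ≡⟨ ∑-𝟙-≟ n y ⟩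
  1                                                     ∎
  where open ≡-Reasoning

Least : ∀ {n} → (Fin n → Set) → Fin n → Set
Least P i = P i × (∀ j → j Fin.< i → ¬ P j)

least : ∀ {n} {P : Fin n → Set} → (∀ i → Dec (P i)) → ∃ P → ∃ (Least P)
least {n} {P} P? (i , Pi) =
  let j , ¬¬Pj , below = Finₚ.¬∀⟶∃¬-smallest n (¬_ ∘ P) (¬? ∘ P?) (λ ∀¬P → ∀¬P i Pi)
  in j , decidable-stable (P? j) ¬¬Pj ,
     λ k k<j → subst (¬_ ∘ P) (Finₚ.toℕ-injective (trans (Finₚ.toℕ-inject _) (Finₚ.toℕ-fromℕ< k<j))) (below (Fin.fromℕ< k<j))

least-zero : ∀ {n} {P : Fin (suc n) → Set} {i} → Least P i → P zero → i ≡ zero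
least-zero {i = zero} _ _ = refl
least-zero {i = suc _} (_ , below) P₀ = ⊥-elim (below zero (s≤s z≤n) P₀)

least-unique : ∀ {n} {P Q : Fin n → Set} {i j} → (∀ k → P k → Q k) → (∀ k → Q k → P k) →
               Least P i → Least Q j → i ≡ j
least-unique {i = i} {j} P⇒Q Q⇒P (Pi , below-i) (Qj , below-j) with Finₚ.<-cmp i j
... | tri< i<j _ _ = ⊥-elim (below-j i i<j (P⇒Q i Pi))
... | tri≈ _ i≡j _ = i≡j
... | tri> _ _ j<i = ⊥-elim (below-i j j<i (Q⇒P j Qj))

run-end : (Q : ℕ → Set) → (∀ t → Dec (Q t)) → ∀ t₀ k → Q t₀ →
          ∃ λ t → t₀ ≤ t × t ≤ t₀ + k × Q t × (t < t₀ + k → ¬ Q (suc t))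
run-end Q Q? t₀ zero Qt₀ = t₀ , ≤-refl , m≤m+n t₀ 0 , Qt₀ , λ t₀<t₀+0 → ⊥-elim (<-irrefl (sym (+-identityʳ t₀)) t₀<t₀+0)
run-end Q Q? t₀ (suc k) Qt₀ with Q? (suc t₀)
... | no ¬Qt₀+1 = t₀ , ≤-refl , m≤m+n t₀ (suc k) , Qt₀ , λ _ → ¬Qt₀+1
... | yes Qt₀+1 =
  let t , t₀+1≤t , t≤ , Qt , stop = run-end Q Q? (suc t₀) k Qt₀+1
  in t , ≤-trans (n≤1+n t₀) t₀+1≤t , subst (t ≤_) (sym (+-suc t₀ k)) t≤ , Qt , stop ∘ subst (t <_) (+-suc t₀ k)

first-crossing : ∀ n p (s : ℕ → ℕ) → 1 ≤ n → s 1 ≤ p → p < s n → ∃ λ t → 1 ≤ t × t < n × s t ≤ p × p < s (suc t)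
first-crossing n p s 1≤n s₁≤p p<sₙ =
  let t , 1≤t , t≤n , sₜ≤p , stop = run-end (λ t → s t ≤ p) (λ t → s t ≤? p) 1 (n ∸ 1) s₁≤p
      t<n = ≤∧≢⇒< (subst (t ≤_) (m+[n∸m]≡n 1≤n) t≤n) λ t≡n → <⇒≱ p<sₙ (subst (λ t → s t ≤ p) t≡n sₜ≤p)
  in t , 1≤t , t<n , sₜ≤p , ≰⇒> (stop (subst (t <_) (sym (m+[n∸m]≡n 1≤n)) t<n))

module Colouring {n r : ℕ} (col : Fin n → Fin r) where

  class : Fin r → ℕ
  class k = ∑[ c < n ] 𝟙 (col c Fin.≟ k)

  class-total : ∑[ k < r ] class k ≡ n
  class-total = begin
    ∑[ k < r ] ∑[ c < n ] 𝟙 (col c Fin.≟ k)   ≡⟨ ∑-comm (λ k c → 𝟙 (col c Fin.≟ k)) ⟩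
    ∑[ c < n ] ∑[ k < r ] 𝟙 (col c Fin.≟ k)   ≡⟨ sum-cong-≗ (λ c → trans (sum-cong-≗ (λ k → 𝟙-cong (col c Fin.≟ k) (k Fin.≟ col c) sym sym)) (∑-𝟙-≟ r (col c))) ⟩
    ∑[ c < n ] 1                               ≡⟨ ∑-one n ⟩
    n                                          ∎
    where open ≡-Reasoning

  monochromatic-pairs : ∑[ b < n ] ∑[ c < n ] 𝟙 (col b Fin.≟ col c) ≡ ∑[ k < r ] (class k * class k)
  monochromatic-pairs = begin
    ∑[ b < n ] ∑[ c < n ] 𝟙 (col b Fin.≟ col c)       ≡⟨ sum-cong-≗ (λ b → sum-cong-≗ (λ c → 𝟙-cong (col b Fin.≟ col c) (col c Fin.≟ col b) sym sym)) ⟩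
    ∑[ b < n ] class (col b)                           ≡⟨ sum-cong-≗ (λ b → ∑-pick r class (col b)) ⟨
    ∑[ b < n ] ∑[ k < r ] (𝟙 (k Fin.≟ col b) * class k) ≡⟨ ∑-comm (λ b k → 𝟙 (k Fin.≟ col b) * class k) ⟩
    ∑[ k < r ] ∑[ b < n ] (𝟙 (k Fin.≟ col b) * class k) ≡⟨ sum-cong-≗ (λ k → *-distribʳ-sum (class k) (λ b → 𝟙 (k Fin.≟ col b))) ⟨
    ∑[ k < r ] (∑[ b < n ] 𝟙 (k Fin.≟ col b) * class k) ≡⟨ sum-cong-≗ (λ k → cong (_* class k) (sum-cong-≗ (λ b → 𝟙-cong (k Fin.≟ col b) (col b Fin.≟ k) sym sym))) ⟩
    ∑[ k < r ] (class k * class k)                     ∎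
    where open ≡-Reasoning

  all-pairs : ∑[ b < n ] ∑[ c < n ] 𝟙 (¬? (col b Fin.≟ col c)) + ∑[ b < n ] ∑[ c < n ] 𝟙 (col b Fin.≟ col c) ≡ n * n
  all-pairs = begin
    ∑[ b < n ] ∑[ c < n ] 𝟙 (¬? (col b Fin.≟ col c)) + ∑[ b < n ] ∑[ c < n ] 𝟙 (col b Fin.≟ col c)
      ≡⟨ ∑∑-distrib-+ n (λ b c → 𝟙 (¬? (col b Fin.≟ col c))) (λ b c → 𝟙 (col b Fin.≟ col c)) ⟨
    ∑[ b < n ] ∑[ c < n ] (𝟙 (¬? (col b Fin.≟ col c)) + 𝟙 (col b Fin.≟ col c))
      ≡⟨ sum-cong-≗ (λ b → trans (sum-cong-≗ (λ c → 𝟙-¬ (col b Fin.≟ col c))) (∑-one n)) ⟩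
    ∑[ b < n ] n
      ≡⟨ ∑-const n n ⟩
    n * n ∎
    where open ≡-Reasoning

bichromatic-pairs : ∀ {n} (col : Fin n → Fin 3) → let open Colouring col; X = class 0F; Y = class 1F; Z = class 2F in
                    ∑[ b < n ] ∑[ c < n ] 𝟙 (¬? (col b Fin.≟ col c)) ≡ 2 * (X * Y + Y * Z + Z * X)
bichromatic-pairs {n} col = +-cancelʳ-≡ _ _ (2 * (X * Y + Y * Z + Z * X)) (begin
  B + M                                     ≡⟨ all-pairs ⟩
  n * n                                     ≡⟨ cong (λ k → k * k) class-total ⟨
  (X + (Y + (Z + 0))) * (X + (Y + (Z + 0)))  ≡⟨ square-of-sum X Y Z ⟩
  2 * (X * Y + Y * Z + Z * X) + M′          ≡⟨ cong (2 * (X * Y + Y * Z + Z * X) +_) monochromatic-pairs ⟨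
  2 * (X * Y + Y * Z + Z * X) + M           ∎)
  where
  open Colouring col
  open ≡-Reasoning
  X = class 0F
  Y = class 1F
  Z = class 2F
  B = ∑[ b < n ] ∑[ c < n ] 𝟙 (¬? (col b Fin.≟ col c))
  M = ∑[ b < n ] ∑[ c < n ] 𝟙 (col b Fin.≟ col c)
  M′ = X * X + (Y * Y + (Z * Z + 0))
  square-of-sum : ∀ X Y Z → (X + (Y + (Z + 0))) * (X + (Y + (Z + 0))) ≡ 2 * (X * Y + Y * Z + Z * X) + (X * X + (Y * Y + (Z * Z + 0)))
  square-of-sum = solve-∀

-- the minimum is attained at (X , Y , Z) = (1 , q , p); the excess is a x + b c in the slack variables
band : ℕ → ℕ → Fin 3
band t j with <-cmp j t
... | tri< _ _ _ = 0F
... | tri≈ _ _ _ = 1F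
... | tri> _ _ _ = 2F

band-0 : ∀ t j → 𝟙 (band t j Fin.≟ 0F) ≡ 𝟙 (j <? t)
band-0 t j with <-cmp j t
... | tri< j<t _ _ = sym (𝟙-yes (j <? t) j<t)
... | tri≈ j≮t _ _ = sym (𝟙-no (j <? t) j≮t)
... | tri> j≮t _ _ = sym (𝟙-no (j <? t) j≮t)

band-0∨1 : ∀ t j → 𝟙 (band t j Fin.≟ 0F) + 𝟙 (band t j Fin.≟ 1F) ≡ 𝟙 (j <? suc t)
band-0∨1 t j with <-cmp j t
... | tri< j<t _ _ = sym (𝟙-yes (j <? suc t) (m<n⇒m<1+n j<t))
... | tri≈ _ refl _ = sym (𝟙-yes (j <? suc t) (n<1+n j))
... | tri> _ _ t<j = sym (𝟙-no (j <? suc t) λ j<1+t → <⇒≱ t<j (≤-pred j<1+t))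

halves-exceed : ∀ n a b e → e ≤ 1 → n < 2 * a → n < 2 * b + e → n < a + b
halves-exceed n a b e e≤1 n<2a n<2b+e = ≤-pred (*-cancelˡ-< 2 (suc n) (suc (a + b)) (begin-strict
  2 * suc n            ≡⟨ double-suc n ⟩
  suc n + suc n        ≤⟨ +-mono-≤ n<2a (≤-trans n<2b+e (+-monoʳ-≤ (2 * b) e≤1)) ⟩
  2 * a + (2 * b + 1)  <⟨ ≤-reflexive (double-sum a b) ⟩
  2 * suc (a + b)      ∎))
  where
  open ≤-Reasoning
  double-suc : ∀ n → 2 * suc n ≡ suc n + suc n
  double-suc = solve-∀
  double-sum : ∀ a b → suc (2 * a + (2 * b + 1)) ≡ 2 * suc (a + b)
  double-sum = solve-∀

three-part-product-bound : ∀ p q X Y Z → X + Y + Z ≡ suc (p + q) → 1 ≤ X → X ≤ p → Y ≤ q → Z ≤ q →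
                           p * q + p + q ≤ X * Y + Y * Z + Z * X
three-part-product-bound p q (suc x) Y Z sum _ X≤p Y≤q Z≤q
  with m≤n⇒∃[o]m+o≡n X≤p | m≤n⇒∃[o]m+o≡n Y≤q | m≤n⇒∃[o]m+o≡n Z≤q
... | a , refl | b , refl | c , Z+c≡Y+b = begin
  (suc x + a) * (Y + b) + (suc x + a) + (Y + b)
    ≡⟨ cong (λ y → (suc x + a) * (y + b) + (suc x + a) + (y + b)) Y≡ ⟩
  (suc x + a) * (suc (a + c) + b) + (suc x + a) + (suc (a + c) + b)
    ≤⟨ m≤m+n _ (a * x + b * c) ⟩
  (suc x + a) * (suc (a + c) + b) + (suc x + a) + (suc (a + c) + b) + (a * x + b * c)
    ≡⟨ excess x a b c ⟨
  suc x * suc (a + c) + suc (a + c) * suc (a + b) + suc (a + b) * suc x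
    ≡⟨ cong₂ (λ y z → suc x * y + y * z + z * suc x) Y≡ Z≡ ⟨
  suc x * Y + Y * Z + Z * suc x ∎
  where
  open ≤-Reasoning
  excess : ∀ x a b c → suc x * suc (a + c) + suc (a + c) * suc (a + b) + suc (a + b) * suc x
                     ≡ (suc x + a) * (suc (a + c) + b) + (suc x + a) + (suc (a + c) + b) + (a * x + b * c)
  excess = solve-∀
  Z≡ : Z ≡ suc (a + b)
  Z≡ = +-cancelˡ-≡ (suc x + Y) Z (suc (a + b)) (trans sum (rearrange₁ x a Y b))
    where
    rearrange₁ : ∀ x a Y b → suc (suc x + a + (Y + b)) ≡ suc x + Y + suc (a + b)
    rearrange₁ = solve-∀
  Y≡ : Y ≡ suc (a + c)
  Y≡ = +-cancelʳ-≡ b Y (suc (a + c)) (trans (sym Z+c≡Y+b) (trans (cong (_+ c) Z≡) (rearrange₂ a b c)))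
    where
    rearrange₂ : ∀ a b c → suc (a + b) + c ≡ suc (a + c) + b
    rearrange₂ = solve-∀

module _ {n : ℕ} where

  Spans : Fin n → Fin n → Pair2 n → Set
  Spans a b ((x , y) , _) = (a ≡ x × b ≡ y) ⊎ (a ≡ y × b ≡ x)

  spans? : ∀ a b p → Dec (Spans a b p)
  spans? a b ((x , y) , _) = (a Fin.≟ x ×-dec b Fin.≟ y) ⊎-dec (a Fin.≟ y ×-dec b Fin.≟ x)

  spans-sym : ∀ {a b} p → Spans a b p → Spans b a p
  spans-sym _ = [ (λ { (e , f) → inj₂ (f , e) }) , (λ { (e , f) → inj₁ (f , e) }) ]

  spans-distinct : ∀ {a b} p → Spans a b p → a ≢ b
  spans-distinct (_ , x<y) (inj₁ (refl , refl)) refl = Finₚ.<-irrefl refl x<y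
  spans-distinct (_ , x<y) (inj₂ (refl , refl)) refl = Finₚ.<-irrefl refl x<y

  spans-endpoint : ∀ {a b z} p → Spans a b p → z ∈₂ p → z ≡ a ⊎ z ≡ b
  spans-endpoint _ (inj₁ (refl , refl)) = [ inj₁ , inj₂ ]
  spans-endpoint _ (inj₂ (refl , refl)) = [ inj₂ , inj₁ ]

  spans-first : ∀ {a b} p → Spans a b p → a ∈₂ p
  spans-first _ (inj₁ (refl , refl)) = inj₁ refl
  spans-first _ (inj₂ (refl , refl)) = inj₂ refl

  spans-unique : ∀ {a b} p q → Spans a b p → Spans a b q → p ≡ q
  spans-unique (_ , x<y) (_ , x<y′) (inj₁ (refl , refl)) (inj₁ (refl , refl)) =
    cong (_ ,_) (Finₚ.<-irrelevant x<y x<y′)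
  spans-unique (_ , x<y) (_ , y<x) (inj₁ (refl , refl)) (inj₂ (refl , refl)) = ⊥-elim (Finₚ.<-asym x<y y<x)
  spans-unique (_ , y<x) (_ , x<y) (inj₂ (refl , refl)) (inj₁ (refl , refl)) = ⊥-elim (Finₚ.<-asym x<y y<x)
  spans-unique (_ , x<y) (_ , x<y′) (inj₂ (refl , refl)) (inj₂ (refl , refl)) =
    cong (_ ,_) (Finₚ.<-irrelevant x<y x<y′)

  -- {a,b} Δ {b,c} = {a,c}
  spans-adjacent : ∀ {a b c} p q → Spans a b p → Spans b c q → a ≢ c → E (F₂K n) p q
  spans-adjacent {a} {b} {c} p q ab bc a≢c = a , c , a≢c , a≢c , λ z → mk⇔ (to z) (from z)
    where
    to : ∀ z → inSymDiff z p q → z ≡ a ⊎ z ≡ c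
    to z (inj₁ (z∈p , z∉q)) with spans-endpoint p ab z∈p
    ... | inj₁ z≡a = inj₁ z≡a
    ... | inj₂ refl = ⊥-elim (z∉q (spans-first q bc))
    to z (inj₂ (z∈q , z∉p)) with spans-endpoint q bc z∈q
    ... | inj₁ refl = ⊥-elim (z∉p (spans-first p (spans-sym p ab)))
    ... | inj₂ z≡c = inj₂ z≡c
    from : ∀ z → z ≡ a ⊎ z ≡ c → inSymDiff z p q
    from z (inj₁ refl) = inj₁ (spans-first p ab ,
      λ a∈q → [ spans-distinct p ab , a≢c ] (spans-endpoint q bc a∈q))
    from z (inj₂ refl) = inj₂ (spans-first q (spans-sym q bc) ,
      λ c∈p → [ (λ c≡a → a≢c (sym c≡a)) , (λ c≡b → spans-distinct q bc (sym c≡b)) ] (spans-endpoint p ab c∈p))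

∑∑-𝟙-spans : ∀ {n} (h : Pair2 n) → ∑[ b < n ] ∑[ c < n ] 𝟙 (spans? b c h) ≤ 2
∑∑-𝟙-spans {n} h@((x , y) , _) = begin
  ∑[ b < n ] ∑[ c < n ] 𝟙 (spans? b c h)
    ≤⟨ ∑-mono-≤ n (λ b → ∑-mono-≤ n (λ c → 𝟙-⊎ (spans? b c h) (xy b c) (yx b c) id)) ⟩
  ∑[ b < n ] ∑[ c < n ] (𝟙 (xy b c) + 𝟙 (yx b c))
    ≡⟨ ∑∑-distrib-+ n (λ b c → 𝟙 (xy b c)) (λ b c → 𝟙 (yx b c)) ⟩
  ∑[ b < n ] ∑[ c < n ] 𝟙 (xy b c) + ∑[ b < n ] ∑[ c < n ] 𝟙 (yx b c)
    ≡⟨ cong₂ _+_ (∑∑-𝟙-point n x y) (∑∑-𝟙-point n y x) ⟩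
  2 ∎
  where
  open ≤-Reasoning
  xy = λ b c → b Fin.≟ x ×-dec c Fin.≟ y
  yx = λ b c → b Fin.≟ y ×-dec c Fin.≟ x

∑∑-𝟙-spanned : ∀ {n} (H : List (Pair2 n)) → ∑[ b < n ] ∑[ c < n ] 𝟙 (any? (spans? b c) H) ≤ 2 * length H
∑∑-𝟙-spanned {n} [] = ≤-reflexive (trans (sum-cong-≗ {n} (λ b → trans (sum-cong-≗ {n} (λ c → 𝟙-no (any? (spans? b c) []) λ ())) (∑-zero n))) (∑-zero n))
∑∑-𝟙-spanned {n} (h ∷ H) = begin
  ∑[ b < n ] ∑[ c < n ] 𝟙 (any? (spans? b c) (h ∷ H))
    ≤⟨ ∑-mono-≤ n (λ b → ∑-mono-≤ n (λ c → 𝟙-⊎ (any? (spans? b c) (h ∷ H)) (spans? b c h) (any? (spans? b c) H) Any.toSum)) ⟩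
  ∑[ b < n ] ∑[ c < n ] (𝟙 (spans? b c h) + 𝟙 (any? (spans? b c) H))
    ≡⟨ ∑∑-distrib-+ n (λ b c → 𝟙 (spans? b c h)) (λ b c → 𝟙 (any? (spans? b c) H)) ⟩
  ∑[ b < n ] ∑[ c < n ] 𝟙 (spans? b c h) + ∑[ b < n ] ∑[ c < n ] 𝟙 (any? (spans? b c) H)
    ≤⟨ +-mono-≤ (∑∑-𝟙-spans h) (∑∑-𝟙-spanned H) ⟩
  2 + 2 * length H
    ≡⟨ *-distribˡ-+ 2 1 (length H) ⟨
  2 * length (h ∷ H) ∎
  where open ≤-Reasoning

-- an arbitrary token when a ≡ b
token : ∀ {m} → Fin (suc (suc m)) → Fin (suc (suc m)) → Pair2 (suc (suc m))
token a b with Finₚ.<-cmp a b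
... | tri< a<b _ _ = (a , b) , a<b
... | tri≈ _ _ _ = (zero , suc zero) , s≤s z≤n
... | tri> _ _ b<a = (b , a) , b<a

token-spans : ∀ {m} {a b : Fin (suc (suc m))} → a ≢ b → Spans a b (token a b)
token-spans {a = a} {b} a≢b with Finₚ.<-cmp a b
... | tri< _ _ _ = inj₁ (refl , refl)
... | tri≈ _ a≡b _ = ⊥-elim (a≢b a≡b)
... | tri> _ _ _ = inj₂ (refl , refl)

EqOrBiadjacent : (G : Graph) → V G → V G → Set
EqOrBiadjacent G u v = u ≡ v ⊎ (E G u v × E G v u)

module _ (G : Graph) (X : VSet G) where

  _++ʷ_ : ∀ {x y z} → WalkIn G X x y → WalkIn G X y z → WalkIn G X x z
  stay ++ʷ w = w
  step e y∈X w′ ++ʷ w = step e y∈X (w′ ++ʷ w)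

  private
    walk-from-head : ∀ {u l x} → All X (u ∷ l) → Linked (EqOrBiadjacent G) (u ∷ l) → x ∈ u ∷ l → WalkIn G X u x
    walk-from-head _ _ (here refl) = stay
    walk-from-head (_ ∷ Xl) (inj₁ refl ∷ lk) (there x∈l) = walk-from-head Xl lk x∈l
    walk-from-head (_ ∷ Xl) (inj₂ (e , _) ∷ lk) (there x∈l) = step e (All.head Xl) (walk-from-head Xl lk x∈l)

    walk-to-head : ∀ {u l x} → All X (u ∷ l) → Linked (EqOrBiadjacent G) (u ∷ l) → x ∈ u ∷ l → WalkIn G X x u
    walk-to-head _ _ (here refl) = stay
    walk-to-head (_ ∷ Xl) (inj₁ refl ∷ lk) (there x∈l) = walk-to-head Xl lk x∈l
    walk-to-head (Xu ∷ Xl) (inj₂ (_ , e) ∷ lk) (there x∈l) = walk-to-head Xl lk x∈l ++ʷ step e Xu stay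

  linked-walk : ∀ {l x y} → All X l → Linked (EqOrBiadjacent G) l → x ∈ l → y ∈ l → WalkIn G X x y
  linked-walk {_ ∷ _} Xl lk x∈l y∈l = walk-to-head Xl lk x∈l ++ʷ walk-from-head Xl lk y∈l

module WalkBramble (m : ℕ) where

  n : ℕ
  n = suc (suc m)

  open DecMembership (Fin._≟_ {n}) using (_∈?_)

  edges : List (Fin n) → List (Pair2 n)
  edges (a ∷ b ∷ w) = token a b ∷ edges (b ∷ w)
  edges _ = []

  EdgeSet : List (Fin n) → VSet (F₂K n)
  EdgeSet w p = p ∈ edges w

  edges-linked : ∀ {w} → Linked _≢_ w → Linked (EqOrBiadjacent (F₂K n)) (edges w)
  edges-linked [] = []
  edges-linked [-] = []
  edges-linked (_ ∷ [-]) = [-]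
  edges-linked {a ∷ b ∷ c ∷ w} (a≢b ∷ b≢c ∷ lk) = consecutive ∷ edges-linked (b≢c ∷ lk)
    where
    ab = token-spans a≢b
    bc = token-spans b≢c
    consecutive : EqOrBiadjacent (F₂K n) (token a b) (token b c)
    consecutive with a Fin.≟ c
    ... | yes refl = inj₁ (spans-unique (token a b) (token b a) ab (spans-sym (token b c) bc))
    ... | no a≢c = inj₂ (spans-adjacent (token a b) (token b c) ab bc a≢c ,
                          spans-adjacent (token b c) (token a b) (spans-sym (token b c) bc) (spans-sym (token a b) ab) (a≢c ∘ sym))

  edgeSet-connected : ∀ {a b w} → Linked _≢_ (a ∷ b ∷ w) → Connected (F₂K n) (EdgeSet (a ∷ b ∷ w))
  edgeSet-connected lk = (_ , here refl) , λ _ _ →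
    linked-walk (F₂K n) (EdgeSet _) (All.tabulate id) (edges-linked lk)

  incident-edge : ∀ {w z} → Linked _≢_ w → 2 ≤ length w → z ∈ w → ∃₂ λ y p → p ∈ edges w × Spans z y p
  incident-edge {_ ∷ []} _ (s≤s ()) _
  incident-edge {a ∷ b ∷ _} (a≢b ∷ _) _ (here refl) = b , token a b , here refl , token-spans a≢b
  incident-edge {a ∷ b ∷ _} (a≢b ∷ _) _ (there (here refl)) =
    a , token a b , here refl , spans-sym (token a b) (token-spans a≢b)
  incident-edge {a ∷ b ∷ c ∷ _} (_ ∷ lk) _ (there (there z∈w)) =
    let y , p , p∈ , zy = incident-edge lk (s≤s (s≤s z≤n)) (there z∈w) in y , p , there p∈ , zy

  -- {z,y₁} and {z,y₂} are equal or adjacent tokens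
  touch-at : ∀ {w₁ w₂ z} → Linked _≢_ w₁ → 2 ≤ length w₁ → Linked _≢_ w₂ → 2 ≤ length w₂ →
             z ∈ w₁ → z ∈ w₂ → Touch (F₂K n) (EdgeSet w₁) (EdgeSet w₂)
  touch-at lk₁ len₁ lk₂ len₂ z∈w₁ z∈w₂
    with incident-edge lk₁ len₁ z∈w₁ | incident-edge lk₂ len₂ z∈w₂
  ... | y₁ , p , p∈ , zy₁ | y₂ , q , q∈ , zy₂ with y₁ Fin.≟ y₂
  ...   | yes refl = inj₁ (p , p∈ , subst (_∈ edges _) (spans-unique q p zy₂ zy₁) q∈)
  ...   | no y₁≢y₂ = inj₂ (p , q , p∈ , q∈ , spans-adjacent p q (spans-sym p zy₁) zy₂ y₁≢y₂)

  edge-endpoints : ∀ {P : Fin n → Fin n → Set} {w p} → Linked P w → p ∈ edges w →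
                   ∃₂ λ a b → P a b × p ≡ token a b
  edge-endpoints {w = a ∷ b ∷ _} (Pab ∷ _) (here refl) = a , b , Pab , refl
  edge-endpoints {w = _ ∷ _ ∷ _} (_ ∷ lk) (there p∈) = edge-endpoints lk p∈

  support : List (Fin n) → ℕ
  support w = ∑[ a < n ] 𝟙 (a ∈? w)

  support≤n : ∀ w → support w ≤ n
  support≤n w = ≤-trans (∑-mono-≤ n (λ a → 𝟙≤1 (a ∈? w))) (≤-reflexive (∑-one n))

  support-[-] : ∀ v → support (v ∷ []) ≡ 1
  support-[-] v = trans (sum-cong-≗ (λ a → 𝟙-cong (a ∈? v ∷ []) (a Fin.≟ v) (λ { (here a≡v) → a≡v }) here)) (∑-𝟙-≟ n v)

  support≤length : ∀ w → support w ≤ length w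
  support≤length [] = ≤-reflexive (trans (sum-cong-≗ (λ a → 𝟙-no (a ∈? []) λ ())) (∑-zero n))
  support≤length (v ∷ w) = begin
    support (v ∷ w)                                  ≤⟨ ∑-mono-≤ n (λ a → 𝟙-⊎ (a ∈? v ∷ w) (a Fin.≟ v) (a ∈? w) ∈-∷⁻) ⟩
    ∑[ a < n ] (𝟙 (a Fin.≟ v) + 𝟙 (a ∈? w))         ≡⟨ ∑-distrib-+ (λ a → 𝟙 (a Fin.≟ v)) (λ a → 𝟙 (a ∈? w)) ⟩
    ∑[ a < n ] 𝟙 (a Fin.≟ v) + support w             ≤⟨ +-mono-≤ (≤-reflexive (∑-𝟙-≟ n v)) (support≤length w) ⟩
    suc (length w)                                   ∎
    where
    open ≤-Reasoning
    ∈-∷⁻ : ∀ {a} → a ∈ v ∷ w → a ≡ v ⊎ a ∈ w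
    ∈-∷⁻ (here a≡v) = inj₁ a≡v
    ∈-∷⁻ (there a∈w) = inj₂ a∈w

  common-vertex : ∀ w₁ w₂ → n < support w₁ + support w₂ → ∃ λ z → z ∈ w₁ × z ∈ w₂
  common-vertex w₁ w₂ n<s₁+s₂ =
    let z , 1<𝟙+𝟙 = ∑-pigeonhole n (λ a → 𝟙 (a ∈? w₁) + 𝟙 (a ∈? w₂)) (λ _ → 1) (begin-strict
          ∑[ a < n ] 1                         ≡⟨ ∑-one n ⟩
          n                                    <⟨ n<s₁+s₂ ⟩
          support w₁ + support w₂              ≡⟨ ∑-distrib-+ (λ a → 𝟙 (a ∈? w₁)) (λ a → 𝟙 (a ∈? w₂)) ⟨
          ∑[ a < n ] (𝟙 (a ∈? w₁) + 𝟙 (a ∈? w₂)) ∎)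
    in z , 𝟙-both (z ∈? w₁) (z ∈? w₂) 1<𝟙+𝟙
    where open ≤-Reasoning

  -- more than half of the vertices, counting vertex 0 as half a vertex to break ties
  Large : List (Fin n) → Set
  Large w = Linked _≢_ w × 2 ≤ length w × n < 2 * support w + 𝟙 (zero ∈? w)

  large? : ∀ w → Dec (Large w)
  large? w = Linked.linked? (λ a b → ¬? (a Fin.≟ b)) w ×-dec 2 ≤? length w ×-dec n <? 2 * support w + 𝟙 (zero ∈? w)

  large-common-vertex : ∀ w₁ w₂ (d₁ : Dec (zero ∈ w₁)) (d₂ : Dec (zero ∈ w₂)) →
                        n < 2 * support w₁ + 𝟙 d₁ → n < 2 * support w₂ + 𝟙 d₂ → ∃ λ z → z ∈ w₁ × z ∈ w₂
  large-common-vertex w₁ w₂ (yes 0∈w₁) (yes 0∈w₂) _ _ = zero , 0∈w₁ , 0∈w₂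
  large-common-vertex w₁ w₂ (no _) d₂ big₁ big₂ = common-vertex w₁ w₂
    (halves-exceed n (support w₁) (support w₂) (𝟙 d₂) (𝟙≤1 d₂) (subst (n <_) (+-identityʳ _) big₁) big₂)
  large-common-vertex w₁ w₂ (yes _) (no _) big₁ big₂ = common-vertex w₁ w₂ (subst (n <_) (+-comm (support w₂) (support w₁))
    (halves-exceed n (support w₂) (support w₁) 1 ≤-refl (subst (n <_) (+-identityʳ _) big₂) big₁))

  large-touch : ∀ {w₁ w₂} → Large w₁ → Large w₂ → Touch (F₂K n) (EdgeSet w₁) (EdgeSet w₂)
  large-touch {w₁} {w₂} (lk₁ , len₁ , big₁) (lk₂ , len₂ , big₂) =
    let _ , z∈w₁ , z∈w₂ = large-common-vertex w₁ w₂ (zero ∈? w₁) (zero ∈? w₂) big₁ big₂ in touch-at lk₁ len₁ lk₂ len₂ z∈w₁ z∈w₂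

  large-connected : ∀ {w} → Large w → Connected (F₂K n) (EdgeSet w)
  large-connected {[]} (_ , () , _)
  large-connected {_ ∷ []} (_ , s≤s () , _)
  large-connected {_ ∷ _ ∷ _} (lk , _) = edgeSet-connected lk

  listsUpTo : ℕ → List (List (Fin n))
  listsUpTo zero = [] ∷ []
  listsUpTo (suc L) = [] ∷ concatMap (λ a → map (a ∷_) (listsUpTo L)) (allFin n)

  ∈-listsUpTo : ∀ L w → length w ≤ L → w ∈ listsUpTo L
  ∈-listsUpTo zero [] _ = here refl
  ∈-listsUpTo (suc L) [] _ = here refl
  ∈-listsUpTo (suc L) (a ∷ w) (s≤s len≤L) =
    there (∈-concatMap⁺ (λ b → map (b ∷_) (listsUpTo L)) (lose (∈-allFin a) (∈-map⁺ (a ∷_) (∈-listsUpTo L w len≤L))))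

  -- length 2n suffices, as a walk around a spanning tree of k vertices has length 2k - 1
  bramble : List (VSet (F₂K n))
  bramble = map EdgeSet (filter large? (listsUpTo (2 * n)))

  bramble-member : ∀ {X} → X ∈ bramble → ∃ λ w → Large w × X ≡ EdgeSet w
  bramble-member X∈ = let w , w∈ , X≡ = ∈-map⁻ EdgeSet X∈ in w , proj₂ (∈-filter⁻ large? {xs = listsUpTo (2 * n)} w∈) , X≡

  bramble-isBramble : IsBramble (F₂K n) bramble
  bramble-isBramble = All.tabulate (connected ∘ bramble-member) , λ _ _ X∈ Y∈ → touch (bramble-member X∈) (bramble-member Y∈)
    where
    connected : ∀ {X} → (∃ λ w → Large w × X ≡ EdgeSet w) → Connected (F₂K n) X
    connected (_ , large , refl) = large-connected large
    touch : ∀ {X Y} → (∃ λ w → Large w × X ≡ EdgeSet w) → (∃ λ w → Large w × Y ≡ EdgeSet w) → Touch (F₂K n) X Y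
    touch (_ , large₁ , refl) (_ , large₂ , refl) = large-touch large₁ large₂

  hit-large : ∀ {H} → Hits (F₂K n) H bramble → ∀ w → length w ≤ 2 * n → Large w → ∃ λ p → p ∈ H × p ∈ edges w
  hit-large hits w len≤2n large = All.lookup hits (∈-map⁺ EdgeSet (∈-filter⁺ large? (∈-listsUpTo (2 * n) w len≤2n) large))

module Components (m : ℕ) (H : List (Pair2 (suc (suc m)))) where

  open WalkBramble m
  open DecMembership (Fin._≟_ {n}) using (_∈?_)

  Adj : Fin n → Fin n → Set
  Adj a b = a ≢ b × ¬ Any (Spans a b) H

  adj? : ∀ a b → Dec (Adj a b)
  adj? a b = ¬? (a Fin.≟ b) ×-dec ¬? (any? (spans? a b) H)

  adj-sym : ∀ {a b} → Adj a b → Adj b a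
  adj-sym (a≢b , ∉H) = a≢b ∘ sym , ∉H ∘ Any.map (λ {p} → spans-sym p)

  Closed : List (Fin n) → Set
  Closed w = ∀ {x u} → x ∈ w → Adj x u → u ∈ w

  neighbours-inside? : ∀ w x → Dec (∀ u → Adj x u → u ∈ w)
  neighbours-inside? w x = Finₚ.all? (λ u → adj? x u →-dec u ∈? w)

  escape : ∀ w → Closed w ⊎ ∃₂ λ x u → x ∈ w × Adj x u × u ∉ w
  escape w with All.all? (neighbours-inside? w) w
  ... | yes inside = inj₁ λ x∈w xu → All.lookup inside x∈w _ xu
  ... | no ¬inside =
    let x , x∈w , ¬inside-x = find (¬All⇒Any¬ (neighbours-inside? w) w ¬inside)
        u , ¬xu⇒u∈w = Finₚ.¬∀⟶∃¬ n _ (λ u → adj? x u →-dec u ∈? w) ¬inside-x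
        xu , u∉w = ¬→-split (adj? x u) ¬xu⇒u∈w
    in inj₂ (x , u , x∈w , xu , u∉w)

  detour : Fin n → Fin n → List (Fin n) → List (Fin n)
  detour x u [] = []
  detour x u (y ∷ w) with y Fin.≟ x
  ... | yes _ = y ∷ u ∷ y ∷ w
  ... | no _ = y ∷ detour x u w

  module _ {x u : Fin n} where

    ∈-detour⁻ : ∀ {a} w → a ∈ detour x u w → a ∈ w ⊎ a ≡ u
    ∈-detour⁻ (y ∷ w) a∈ with y Fin.≟ x | a∈
    ... | yes _ | here a≡y = inj₁ (here a≡y)
    ... | yes _ | there (here a≡u) = inj₂ a≡u
    ... | yes _ | there (there a∈yw) = inj₁ a∈yw
    ... | no _ | here a≡y = inj₁ (here a≡y)
    ... | no _ | there a∈ = map₁ there (∈-detour⁻ w a∈)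

    ∈-detour⁺ : ∀ {a} w → a ∈ w → a ∈ detour x u w
    ∈-detour⁺ (y ∷ w) a∈ with y Fin.≟ x | a∈
    ... | yes _ | here a≡y = here a≡y
    ... | yes _ | there a∈w = there (there (there a∈w))
    ... | no _ | here a≡y = here a≡y
    ... | no _ | there a∈w = there (∈-detour⁺ w a∈w)

    u∈detour : ∀ w → x ∈ w → u ∈ detour x u w
    u∈detour (y ∷ w) x∈ with y Fin.≟ x | x∈
    ... | yes _ | _ = there (here refl)
    ... | no y≢x | here refl = ⊥-elim (y≢x refl)
    ... | no _ | there x∈w = there (u∈detour w x∈w)

    length-detour : ∀ w → x ∈ w → length (detour x u w) ≡ 2 + length w
    length-detour (y ∷ w) x∈ with y Fin.≟ x | x∈
    ... | yes _ | _ = refl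
    ... | no y≢x | here refl = ⊥-elim (y≢x refl)
    ... | no _ | there x∈w = cong suc (length-detour w x∈w)

    detour-linked : ∀ w → x ∈ w → Adj x u → Linked Adj w → Linked Adj (detour x u w)
    detour-linked (y ∷ w) x∈ xu lk with y Fin.≟ x | x∈
    ... | yes refl | _ = xu ∷ adj-sym xu ∷ lk
    ... | no y≢x | here refl = ⊥-elim (y≢x refl)
    detour-linked (y ∷ z ∷ w) _ xu (yz ∷ lk) | no _ | there x∈ with z Fin.≟ x | detour-linked (z ∷ w) x∈ xu lk
    ... | yes _ | rest = yz ∷ rest
    ... | no _ | rest = yz ∷ rest

    support-detour : ∀ w → x ∈ w → u ∉ w → support (detour x u w) ≡ suc (support w)
    support-detour w x∈w u∉w = begin
      support (detour x u w)                     ≡⟨ sum-cong-≗ split ⟩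
      ∑[ a < n ] (𝟙 (a ∈? w) + 𝟙 (a Fin.≟ u))     ≡⟨ ∑-distrib-+ (λ a → 𝟙 (a ∈? w)) (λ a → 𝟙 (a Fin.≟ u)) ⟩
      support w + ∑[ a < n ] 𝟙 (a Fin.≟ u)       ≡⟨ cong (support w +_) (∑-𝟙-≟ n u) ⟩
      support w + 1                              ≡⟨ +-comm (support w) 1 ⟩
      suc (support w)                            ∎
      where
      open ≡-Reasoning
      split : ∀ a → 𝟙 (a ∈? detour x u w) ≡ 𝟙 (a ∈? w) + 𝟙 (a Fin.≟ u)
      split a = 𝟙-disjoint-⊎ (a ∈? detour x u w) (a ∈? w) (a Fin.≟ u) (∈-detour⁻ w) (∈-detour⁺ w)
                  (λ { refl → u∈detour w x∈w }) (λ { (a∈w , refl) → u∉w a∈w })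

  record Component (v : Fin n) : Set where
    field
      walk : List (Fin n)
      linked : Linked Adj walk
      closed : Closed walk
      ∋v : v ∈ walk
      short : length walk ≤ 2 * support walk

  -- each detour adds one vertex, so n steps suffice
  grow : ∀ {v} fuel w → Linked Adj w → v ∈ w → length w ≤ 2 * support w → n ≤ fuel + support w → Component v
  grow fuel w lk v∈w short enough with escape w
  ... | inj₁ closed = record { walk = w ; linked = lk ; closed = closed ; ∋v = v∈w ; short = short }
  ... | inj₂ (x , u , x∈w , xu , u∉w) with fuel
  ...   | zero = ⊥-elim (<⇒≱ (subst (_≤ n) (support-detour w x∈w u∉w) (support≤n (detour x u w))) enough)
  ...   | suc fuel′ = grow fuel′ (detour x u w) (detour-linked w x∈w xu lk) (∈-detour⁺ w v∈w) short′ enough′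
    where
    short′ : length (detour x u w) ≤ 2 * support (detour x u w)
    short′ = begin
      length (detour x u w)     ≡⟨ length-detour w x∈w ⟩
      2 + length w              ≤⟨ +-monoʳ-≤ 2 short ⟩
      2 + 2 * support w         ≡⟨ *-distribˡ-+ 2 1 (support w) ⟨
      2 * suc (support w)       ≡⟨ cong (2 *_) (support-detour w x∈w u∉w) ⟨
      2 * support (detour x u w) ∎
      where open ≤-Reasoning
    enough′ : n ≤ fuel′ + support (detour x u w)
    enough′ = subst (n ≤_) (trans (sym (+-suc fuel′ (support w))) (cong (fuel′ +_) (sym (support-detour w x∈w u∉w)))) enough

  -- opaque: unfolding the search in the types of later lemmas makes checking them very slow
  opaque
    component : ∀ v → Component v
    component v = grow n (v ∷ []) [-] (here refl) (subst (λ s → 1 ≤ 2 * s) (sym (support-[-] v)) (s≤s z≤n))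
                    (subst (λ s → n ≤ n + s) (sym (support-[-] v)) (m≤m+n n 1))

module LowerBound (m : ℕ) (H : List (Pair2 (suc (suc (suc m)))))
                  (hits : Hits (F₂K (suc (suc (suc m)))) H (WalkBramble.bramble (suc m))) where

  open WalkBramble (suc m)
  open Components (suc m) H
  open DecMembership (Fin._≟_ {n}) using (_∈?_)

  W : Fin n → List (Fin n)
  W v = Component.walk (component v)

  -- a component through more than half of the vertices would give a bramble member missed by H
  component-small : ∀ v → 2 * support (W v) + 𝟙 (zero ∈? W v) ≤ n
  component-small v with large? (W v)
  ... | yes large =
    let p , p∈H , p∈walk = hit-large hits (W v) short large
        a , b , (a≢b , ab∉H) , p≡ab = edge-endpoints (Component.linked (component v)) p∈walk
    in ⊥-elim (ab∉H (lose p∈H (subst (Spans a b) (sym p≡ab) (token-spans a≢b))))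
    where
    short : length (W v) ≤ 2 * n
    short = ≤-trans (Component.short (component v)) (*-monoʳ-≤ 2 (support≤n (W v)))
  ... | no ¬large = ≮⇒≥ λ big → ¬large (Linked.map proj₁ (Component.linked (component v)) ,
                                         ≤-trans (two-vertices big) (support≤length (W v)) , big)
    where
    two-vertices : n < 2 * support (W v) + 𝟙 (zero ∈? W v) → 2 ≤ support (W v)
    two-vertices big = ≮⇒≥ λ s<2 → <⇒≱ big (≤-trans (+-mono-≤ (*-monoʳ-≤ 2 (≤-pred s<2)) (𝟙≤1 (zero ∈? W v))) (m≤m+n 3 m))

  rep-least : ∀ c → ∃ (Least (λ a → c ∈ W a))
  rep-least c = least (λ a → c ∈? W a) (c , Component.∋v (component c))

  rep : Fin n → Fin n
  rep c = proj₁ (rep-least c)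

  rep-∈ : ∀ c → c ∈ W (rep c)
  rep-∈ c = proj₁ (proj₂ (rep-least c))

  rep-zero : rep zero ≡ zero
  rep-zero = least-zero (proj₂ (rep-least zero)) (Component.∋v (component zero))

  rep-adj : ∀ {c d} → Adj c d → rep c ≡ rep d
  rep-adj cd = least-unique (λ a c∈ → Component.closed (component a) c∈ cd)
                            (λ a d∈ → Component.closed (component a) d∈ (adj-sym cd))
                            (proj₂ (rep-least _)) (proj₂ (rep-least _))

  below : ℕ → ℕ
  below t = ∑[ c < n ] 𝟙 (toℕ (rep c) <? t)

  below-n : below n ≡ n
  below-n = trans (sum-cong-≗ (λ c → 𝟙-yes (toℕ (rep c) <? n) (Finₚ.toℕ<n (rep c)))) (∑-one n)

  below-step : ∀ t → (t<n : t < n) → below (suc t) ≤ below t + support (W (Fin.fromℕ< t<n))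
  below-step t t<n = begin
    below (suc t)
      ≤⟨ ∑-mono-≤ n (λ c → 𝟙-⊎ (toℕ (rep c) <? suc t) (toℕ (rep c) <? t) (c ∈? W a) (split c)) ⟩
    ∑[ c < n ] (𝟙 (toℕ (rep c) <? t) + 𝟙 (c ∈? W a))
      ≡⟨ ∑-distrib-+ (λ c → 𝟙 (toℕ (rep c) <? t)) (λ c → 𝟙 (c ∈? W a)) ⟩
    below t + support (W a) ∎
    where
    open ≤-Reasoning
    a = Fin.fromℕ< t<n
    split : ∀ c → toℕ (rep c) < suc t → toℕ (rep c) < t ⊎ c ∈ W a
    split c r<1+t with m≤n⇒m<n∨m≡n (≤-pred r<1+t)
    ... | inj₁ r<t = inj₁ r<t
    ... | inj₂ r≡t = inj₂ (subst (λ a → c ∈ W a) (Finₚ.toℕ-injective (trans r≡t (sym (Finₚ.toℕ-fromℕ< t<n)))) (rep-∈ c))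

  module _ (p q : ℕ) (n≡ : n ≡ suc (p + q)) (p≤q : p ≤ q) (q≤1+p : q ≤ suc p) where

    component-≤q : ∀ a → support (W a) ≤ q
    component-≤q a = ≤-pred (*-cancelˡ-< 2 _ _ (begin-strict
      2 * support (W a)                       ≤⟨ m≤m+n _ _ ⟩
      2 * support (W a) + 𝟙 (zero ∈? W a)    ≤⟨ component-small a ⟩
      n                                       ≡⟨ n≡ ⟩
      suc (p + q)                             ≤⟨ s≤s (+-monoˡ-≤ q p≤q) ⟩
      suc (q + q)                             <⟨ ≤-reflexive (double-suc q) ⟩
      2 * suc q                               ∎))
      where
      open ≤-Reasoning
      double-suc : ∀ q → suc (suc (q + q)) ≡ 2 * suc q
      double-suc = solve-∀

    component₀-≤p : support (W zero) ≤ p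
    component₀-≤p = ≤-pred (*-cancelˡ-< 2 _ _ (begin-strict
      2 * support (W zero)                          <⟨ ≤-reflexive (+-comm 1 _) ⟩
      2 * support (W zero) + 1                      ≡⟨ cong (2 * support (W zero) +_) (𝟙-yes (zero ∈? W zero) (Component.∋v (component zero))) ⟨
      2 * support (W zero) + 𝟙 (zero ∈? W zero)    ≤⟨ component-small zero ⟩
      n                                             ≡⟨ n≡ ⟩
      suc (p + q)                                   ≤⟨ s≤s (+-monoʳ-≤ p q≤1+p) ⟩
      suc (p + suc p)                               ≡⟨ double-suc p ⟩
      2 * suc p                                     ∎))
      where
      open ≤-Reasoning
      double-suc : ∀ p → suc (p + suc p) ≡ 2 * suc p
      double-suc = solve-∀

    below-1≤p : below 1 ≤ p
    below-1≤p = ≤-trans (below-step 0 (s≤s z≤n)) (subst (λ k → k + support (W zero) ≤ p) (sym below-0) component₀-≤p)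
      where
      below-0 : below 0 ≡ 0
      below-0 = trans (sum-cong-≗ (λ c → 𝟙-no (toℕ (rep c) <? 0) λ ())) (∑-zero n)

    module ThreeColouring (t : ℕ) (1≤t : 1 ≤ t) (t<n : t < n) (below-t≤p : below t ≤ p) (p<below-1+t : p < below (suc t)) where

      col : Fin n → Fin 3
      col c = band t (toℕ (rep c))

      open Colouring col

      X Y Z : ℕ
      X = class 0F
      Y = class 1F
      Z = class 2F

      X≡ : X ≡ below t
      X≡ = sum-cong-≗ (λ c → band-0 t (toℕ (rep c)))

      X+Y≡ : X + Y ≡ below (suc t)
      X+Y≡ = trans (sym (∑-distrib-+ (λ c → 𝟙 (col c Fin.≟ 0F)) (λ c → 𝟙 (col c Fin.≟ 1F))))
                   (sum-cong-≗ (λ c → band-0∨1 t (toℕ (rep c))))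

      X+Y+Z≡ : X + Y + Z ≡ suc (p + q)
      X+Y+Z≡ = trans (+-assoc X Y Z) (trans (cong (λ z → X + (Y + z)) (sym (+-identityʳ Z))) (trans class-total n≡))

      1≤X : 1 ≤ X
      1≤X = ≤-trans (≤-reflexive (sym (𝟙-yes (toℕ (rep zero) <? t) (subst (λ r → toℕ r < t) (sym rep-zero) 1≤t))))
                    (≤-trans (term≤∑ n (λ c → 𝟙 (toℕ (rep c) <? t)) zero) (≤-reflexive (sym X≡)))

      X≤p : X ≤ p
      X≤p = subst (_≤ p) (sym X≡) below-t≤p

      Y≤q : Y ≤ q
      Y≤q = +-cancelˡ-≤ X Y q (begin
        X + Y                                        ≡⟨ X+Y≡ ⟩
        below (suc t)                                ≤⟨ below-step t t<n ⟩
        below t + support (W (Fin.fromℕ< t<n))       ≤⟨ +-mono-≤ (≤-reflexive (sym X≡)) (component-≤q _) ⟩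
        X + q                                        ∎)
        where open ≤-Reasoning

      Z≤q : Z ≤ q
      Z≤q = +-cancelˡ-≤ (suc p) Z q (begin
        suc p + Z        ≤⟨ +-monoˡ-≤ Z (subst (p <_) (sym X+Y≡) p<below-1+t) ⟩
        X + Y + Z        ≡⟨ X+Y+Z≡ ⟩
        suc (p + q)      ∎)
        where open ≤-Reasoning

      bichromatic⇒spanned : ∀ b c → ¬ col b ≡ col c → Any (Spans b c) H
      bichromatic⇒spanned b c col-b≢col-c with any? (spans? b c) H
      ... | yes spanned = spanned
      ... | no unspanned = ⊥-elim (col-b≢col-c (cong (λ r → band t (toℕ r)) (rep-adj (b≢c , unspanned))))
        where
        b≢c : b ≢ c
        b≢c refl = col-b≢col-c refl

      size-bound : p * q + p + q ≤ length H
      size-bound = *-cancelˡ-≤ 2 (begin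
        2 * (p * q + p + q)                                   ≤⟨ *-monoʳ-≤ 2 (three-part-product-bound p q X Y Z X+Y+Z≡ 1≤X X≤p Y≤q Z≤q) ⟩
        2 * (X * Y + Y * Z + Z * X)                           ≡⟨ bichromatic-pairs col ⟨
        ∑[ b < n ] ∑[ c < n ] 𝟙 (¬? (col b Fin.≟ col c))     ≤⟨ ∑-mono-≤ n (λ b → ∑-mono-≤ n (λ c →
                                                                  𝟙-mono (¬? (col b Fin.≟ col c)) (any? (spans? b c) H) (bichromatic⇒spanned b c))) ⟩
        ∑[ b < n ] ∑[ c < n ] 𝟙 (any? (spans? b c) H)          ≤⟨ ∑∑-𝟙-spanned H ⟩
        2 * length H                                          ∎)
        where open ≤-Reasoning

    hitting-set-size : p * q + p + q ≤ length H
    hitting-set-size =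
      let t , 1≤t , t<n , below-t≤p , p<below-1+t =
            first-crossing n p below (s≤s z≤n) below-1≤p (subst (p <_) (sym (trans below-n n≡)) (s≤s (m≤m+n p q)))
      in ThreeColouring.size-bound t 1≤t t<n below-t≤p p<below-1+t

data Parity : ℕ → Set where
  even : ∀ j → Parity (j + j)
  odd : ∀ j → Parity (suc (j + j))

parity : ∀ k → Parity k
parity zero = even zero
parity (suc k) with parity k
... | even j = odd j
... | odd j = subst Parity (cong suc (+-suc j j)) (even (suc j))

bound-when-even : ∀ N → N % 2 ≡ 0 → bound N ≡ (N / 2) * (N / 2 ∸ 1) + (N ∸ 1)
bound-when-even N N%2≡0 with N % 2
bound-when-even N refl | .0 = refl

bound-when-odd : ∀ N → N % 2 ≡ 1 → bound N ≡ ((N ∸ 1) / 2) ^ 2 + (N ∸ 1)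
bound-when-odd N N%2≡1 with N % 2
bound-when-odd N refl | .1 = refl

record Halving (N : ℕ) : Set where
  field
    p q : ℕ
    N≡ : N ≡ suc (p + q)
    p≤q : p ≤ q
    q≤1+p : q ≤ suc p
    bound≡ : bound N ≡ p * q + p + q

-- p = ⌊(N-1)/2⌋ and q = ⌊N/2⌋
halving : ∀ k → Halving (suc k)
halving k with parity k
... | even j = record { p = j ; q = j ; N≡ = refl ; p≤q = ≤-refl ; q≤1+p = n≤1+n j ; bound≡ = bound-odd }
  where
  double : ∀ i → i + i ≡ i * 2
  double = solve-∀
  bound-odd : bound (suc (j + j)) ≡ j * j + j + j
  bound-odd = begin
    bound (suc (j + j))                         ≡⟨ bound-when-odd (suc (j + j)) (trans (cong (λ k → suc k % 2) (double j)) ([m+kn]%n≡m%n 1 j 2)) ⟩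
    ((j + j) / 2) ^ 2 + (j + j)                 ≡⟨ cong (λ h → h ^ 2 + (j + j)) (trans (cong (_/ 2) (double j)) (m*n/n≡m j 2)) ⟩
    j ^ 2 + (j + j)                             ≡⟨ square-plus j ⟩
    j * j + j + j                               ∎
    where
    open ≡-Reasoning
    square-plus : ∀ i → i * (i * 1) + (i + i) ≡ i * i + i + i
    square-plus = solve-∀
... | odd j = record { p = j ; q = suc j ; N≡ = cong suc (sym (+-suc j j)) ; p≤q = n≤1+n j ; q≤1+p = ≤-refl ; bound≡ = bound-even }
  where
  double : ∀ i → suc (suc (i + i)) ≡ suc i * 2
  double = solve-∀
  bound-even : bound (suc (suc (j + j))) ≡ j * suc j + j + suc j
  bound-even = begin
    bound (suc (suc (j + j)))                     ≡⟨ bound-when-even (suc (suc (j + j))) (trans (cong (_% 2) (double j)) (m*n%n≡0 (suc j) 2)) ⟩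
    (N / 2) * (N / 2 ∸ 1) + suc (j + j)           ≡⟨ cong (λ h → h * (h ∸ 1) + suc (j + j)) (trans (cong (_/ 2) (double j)) (m*n/n≡m (suc j) 2)) ⟩
    suc j * j + suc (j + j)                       ≡⟨ rearrange j ⟩
    j * suc j + j + suc j                         ∎
    where
    open ≡-Reasoning
    N = suc (suc (j + j))
    rearrange : ∀ i → suc i * i + suc (i + i) ≡ i * suc i + i + suc i
    rearrange = solve-∀

mainTheorem7 : ∀ (n : ℕ) → 4 ≤ n → BnAtLeast (F₂K n) (bound n)
mainTheorem7 (suc (suc (suc m))) _ = bramble , bramble-isBramble , λ H hits →
  let open Halving (halving (suc (suc m)))
  in subst (_≤ length H) (sym bound≡) (LowerBound.hitting-set-size m H hits p q N≡ p≤q q≤1+p)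
  where open WalkBramble (suc m)
mainTheorem7 (suc (suc zero)) (s≤s (s≤s ()))
mainTheorem7 (suc zero) (s≤s ())
mainTheorem7 zero ()
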